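{- For any temporal graph $G$ on $n$ vertices with lifetime $L$, one can build a temporal $\lfloor\log n\rfloor$-spanner $H$ of $G$ of size $O(Ln)$.
   Context: A temporal graph is an undirected graph $G=(V,E)$ with $n=|V|$ vertices and a labeling $\lambda:E\to\mathbb{N}^+$; its lifetime $L$ is the number of distinct labels used. A temporal path from $u$ to $v$ is a path whose traversed edges $e_1,\dots,e_m$ satisfy $\lambda(e_i)\le\lambda(e_{i+1})$ for all $i$; its length is $m$. $d_G(u,v)$ is the minimum length of a temporal path from $u$ to $v$ ($+\infty$ if none). A temporal subgraph $H$ of $G$ has $V(H)=V$, $E(H)\subseteq E$ with the same labels. A temporal $\alpha$-spanner of $G$ is a temporal subgraph $H$ with $d_H(u,v)\le\alpha\,d_G(u,v)$ for all $u,v\in V$. The size of $H$ is $|E(H)|$. Logarithms are base 2. -}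

module Defs where

open import Data.Nat using (ℕ; zero; suc; _+_; _*_; _≤_; _<_; _<?_)
open import Data.Nat.Properties using (_≟_)
open import Data.Fin using (Fin; toℕ)
open import Data.List using (List; []; _∷_; length; filter; allFin; cartesianProduct; mapMaybe; deduplicate)
open import Data.List.Relation.Unary.Unique.Propositional using (Unique)
open import Data.Maybe using (Maybe; just; nothing; is-just)
open import Data.Bool using (T)
open import Data.Product using (_×_; _,_; proj₁; proj₂; Σ; ∃-syntax)
open import Relation.Binary.PropositionalEquality using (_≡_)
open import Relation.Nullary.Decidable using (T?)

-- A temporal graph on vertex set Fin n: a simple undirected graph together
-- with a labeling of its edges by positive naturals, encoded as a symmetric,
-- loop-free partial labeling: lab u v ≡ just l  iff  {u,v} is an edge with label l.
record TGraph (n : ℕ) : Set where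
  field
    lab    : Fin n → Fin n → Maybe ℕ
    lab-sym : ∀ u v → lab u v ≡ lab v u
    lab-irr : ∀ u → lab u u ≡ nothing
    lab-pos : ∀ u v l → lab u v ≡ just l → 1 ≤ l
open TGraph public

-- all ordered pairs (u , v) with u < v, i.e. the unordered pairs of distinct vertices
pairs : (n : ℕ) → List (Fin n × Fin n)
pairs n = filter (λ p → toℕ (proj₁ p) <? toℕ (proj₂ p)) (cartesianProduct (allFin n) (allFin n))

size : ∀ {n} → TGraph n → ℕ
size {n} G = length (filter (λ p → T? (is-just (lab G (proj₁ p) (proj₂ p)))) (pairs n))

lifetime : ∀ {n} → TGraph n → ℕ
lifetime {n} G = length (deduplicate _≟_ (mapMaybe (λ p → lab G (proj₁ p) (proj₂ p)) (pairs n)))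

_⊑_ : ∀ {n} → TGraph n → TGraph n → Set
H ⊑ G = ∀ u v l → lab H u v ≡ just l → lab G u v ≡ just l

-- TWalk G lo u v : a walk from u to v whose edge labels are non-decreasing
-- and all at least lo.
data TWalk {n : ℕ} (G : TGraph n) : ℕ → Fin n → Fin n → Set where
  nil  : ∀ {lo u} → TWalk G lo u u
  cons : ∀ {lo u w v l} → lab G u w ≡ just l → lo ≤ l → TWalk G l w v → TWalk G lo u v

len : ∀ {n} {G : TGraph n} {lo u v} → TWalk G lo u v → ℕ
len nil = 0
len (cons _ _ p) = suc (len p)

verts : ∀ {n} {G : TGraph n} {lo u v} → TWalk G lo u v → List (Fin n)
verts {u = u} nil = u ∷ []
verts {u = u} (cons _ _ p) = u ∷ verts p

TPath : ∀ {n} → TGraph n → Fin n → Fin n → Set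
TPath G u v = Σ (TWalk G 0 u v) (λ p → Unique (verts p))

pathLen : ∀ {n} {G : TGraph n} {u v} → TPath G u v → ℕ
pathLen p = len (proj₁ p)

-- H is a temporal α-spanner of G:  d_H(u,v) ≤ α · d_G(u,v) for all u, v,
-- unfolded: every temporal u-v path in G of length m is matched by a
-- temporal u-v path in H of length ≤ α·m (vacuous when d_G(u,v) = ∞).
IsSpanner : ∀ {n} → ℕ → TGraph n → TGraph n → Set
IsSpanner {n} α G H =
  H ⊑ G × (∀ (u v : Fin n) (P : TPath G u v) → ∃[ Q ] (pathLen {G = H} {u} {v} Q ≤ α * pathLen {G = G} P))

module Submission where

-- For a fixed label l, the edges labelled l form a static graph. Grow clusters breadth-first around
-- still uncovered centres, stopping as soon as the boundary is at most 7 times the cluster, and keep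
-- the tree edges plus one edge from each boundary vertex into the cluster: at most 8 edges per
-- covered vertex, so at most 8n in total. A cluster of radius i has at least 8^i vertices, so
-- adjacent vertices are joined by at most 2i + 1 ≤ ⌊log₂ n⌋ kept edges, all labelled l.
-- H is the union of these spanners over the L labels, hence has O(Ln) edges. Replacing each edge
-- of a temporal path of G by its single-label route in H gives a temporal walk, and cutting out
-- repeated vertices turns it into a temporal path at most ⌊log₂ n⌋ times as long.

open import Defs
open import Data.Nat using (ℕ; zero; suc; _+_; _*_; _^_; _≤_; _<_; z≤n; s≤s)
open import Data.Nat.Properties
open import Function using (_∘_)
open import Data.Nat.Logarithm using (⌊log₂_⌋; ⌊log₂⌋-mono-≤; ⌊log₂[2^n]⌋≡n)
open import Data.Fin using (Fin; zero)
import Data.Fin.Properties as Fin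
open import Data.List using (List; []; _∷_; [_]; length; filter; _++_; map; concatMap; mapMaybe; deduplicate; allFin)
open import Data.List.Properties using (length-++; length-map; length-filter; length-tabulate)
open import Data.List.Membership.Propositional using (_∈_; _∉_; find; lose)
open import Data.List.Membership.Propositional.Properties
import Data.List.Membership.DecPropositional as DecMembership
open import Data.List.Relation.Binary.Subset.Propositional using (_⊆_)
open import Data.List.Relation.Unary.Any as Any using (Any; here; there; any?)
open import Data.List.Relation.Unary.All as All using ([])
open import Data.List.Relation.Unary.All.Properties using (¬Any⇒All¬)
open import Data.List.Relation.Unary.AllPairs using ([]; _∷_)
open import Data.List.Relation.Unary.Unique.Propositional using (Unique)
import Data.List.Relation.Unary.Unique.Propositional.Properties as Unique
open import Data.Maybe using (Maybe; just; nothing; is-just)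
import Data.Maybe.Properties as Maybe
open import Data.Product using (_×_; _,_; proj₁; proj₂; Σ; ∃-syntax; swap)
import Data.Product.Properties as Product
open import Data.Sum using (_⊎_; inj₁; inj₂)
open import Data.Empty using (⊥-elim)
open import Level using (0ℓ)
open import Relation.Binary using (Rel; Symmetric) renaming (Decidable to Decidable₂)
open import Relation.Binary.PropositionalEquality using (_≡_; _≢_; refl; sym; trans; cong; subst)
open import Relation.Nullary using (¬_; Dec; yes; no; _×-dec_; _⊎-dec_; ¬?)
open import Relation.Nullary.Decidable using (T?)
open import Relation.Unary using (Pred; Decidable)
open import Relation.Unary.Properties using (U?)

Unique-⊆⇒length≤ : ∀ {A : Set} {xs ys : List A} → Unique xs → xs ⊆ ys → length xs ≤ length ys
Unique-⊆⇒length≤ {xs = []} _ _ = z≤n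
Unique-⊆⇒length≤ {xs = x ∷ xs} (x∉xs ∷ xs!) xs⊆ys with ∈-∃++ (xs⊆ys (here refl))
... | ys₁ , ys₂ , refl = begin
    suc (length xs)                ≤⟨ s≤s (Unique-⊆⇒length≤ xs! xs⊆ys₁++ys₂) ⟩
    suc (length (ys₁ ++ ys₂))      ≡⟨ cong suc (length-++ ys₁) ⟩
    suc (length ys₁ + length ys₂)  ≡⟨ +-suc (length ys₁) (length ys₂) ⟨
    length ys₁ + suc (length ys₂)  ≡⟨ length-++ ys₁ ⟨
    length (ys₁ ++ x ∷ ys₂)        ∎
  where
  open ≤-Reasoning
  xs⊆ys₁++ys₂ : xs ⊆ ys₁ ++ ys₂
  xs⊆ys₁++ys₂ z∈xs with ∈-++⁻ ys₁ (xs⊆ys (there z∈xs))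
  ... | inj₁ z∈ys₁         = ∈-++⁺ˡ z∈ys₁
  ... | inj₂ (here refl)   = ⊥-elim (All.lookup x∉xs z∈xs refl)
  ... | inj₂ (there z∈ys₂) = ∈-++⁺ʳ ys₁ z∈ys₂

length-concatMap-≤ : ∀ {A B : Set} (f : A → List B) {k} → (∀ x → length (f x) ≤ k) →
                     ∀ xs → length (concatMap f xs) ≤ length xs * k
length-concatMap-≤ f bound [] = z≤n
length-concatMap-≤ f bound (x ∷ xs) = begin
  length (f x ++ concatMap f xs)          ≡⟨ length-++ (f x) ⟩
  length (f x) + length (concatMap f xs)  ≤⟨ +-mono-≤ (bound x) (length-concatMap-≤ f bound xs) ⟩
  _                                       ∎
  where open ≤-Reasoning

∈-mapMaybe⁺ : ∀ {A B : Set} (f : A → Maybe B) {x y} {xs} → x ∈ xs → f x ≡ just y → y ∈ mapMaybe f xs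
∈-mapMaybe⁺ f {xs = x ∷ _} (here refl) fx≡y rewrite fx≡y = here refl
∈-mapMaybe⁺ f {xs = x ∷ _} (there x∈xs) fx≡y with f x
... | just _  = there (∈-mapMaybe⁺ f x∈xs fx≡y)
... | nothing = ∈-mapMaybe⁺ f x∈xs fx≡y

covered-by-tail : ∀ {A : Set} {Q : Pred A 0ℓ} {c cs} →
                  (∀ {x} → Q x → x ∈ c ∷ cs) → ¬ Q c → ∀ {x} → Q x → x ∈ cs
covered-by-tail covered ¬Qc Qx with covered Qx
... | here refl  = ⊥-elim (¬Qc Qx)
... | there x∈cs = x∈cs

Unique⇒length≤n : ∀ {n} {xs : List (Fin n)} → Unique xs → length xs ≤ n
Unique⇒length≤n {n} {xs} xs! =
  subst (length xs ≤_) (length-tabulate {n = n} (λ i → i)) (Unique-⊆⇒length≤ xs! (λ {x} _ → ∈-allFin x))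

≢⇒2≤n : ∀ {n} {u w : Fin n} → u ≢ w → 2 ≤ n
≢⇒2≤n {suc zero}    {zero} {zero} u≢w = ⊥-elim (u≢w refl)
≢⇒2≤n {suc (suc n)}               _   = s≤s (s≤s z≤n)

-- Why clusters grow by a factor 8 = 2³: a cluster of radius i then gives stretch 2i + 1 ≤ 3i ≤ ⌊log₂ n⌋.
suc[i+i]≤⌊log₂n⌋ : ∀ {n} i → 8 ^ i ≤ n → 2 ≤ n → suc (i + i) ≤ ⌊log₂ n ⌋
suc[i+i]≤⌊log₂n⌋ {n} zero _ 2≤n = subst (_≤ ⌊log₂ n ⌋) (⌊log₂[2^n]⌋≡n 1) (⌊log₂⌋-mono-≤ 2≤n)
suc[i+i]≤⌊log₂n⌋ {n} i@(suc j) 8^i≤n _ = begin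
  1 + (i + i)           ≤⟨ +-monoˡ-≤ (i + i) (s≤s z≤n) ⟩
  i + (i + i)           ≡⟨ cong (λ t → i + (i + t)) (+-identityʳ i) ⟨
  3 * i                 ≡⟨ ⌊log₂[2^n]⌋≡n (3 * i) ⟨
  ⌊log₂ (2 ^ (3 * i)) ⌋ ≤⟨ ⌊log₂⌋-mono-≤ (subst (_≤ n) (^-*-assoc 2 3 i) 8^i≤n) ⟩
  ⌊log₂ n ⌋             ∎
  where open ≤-Reasoning

module _ {V : Set} where

  Joins : List (V × V) → V → V → Set
  Joins S x y = (x , y) ∈ S ⊎ (y , x) ∈ S

  joins-sym : ∀ {S x y} → Joins S x y → Joins S y x
  joins-sym (inj₁ xy∈S) = inj₂ xy∈S
  joins-sym (inj₂ yx∈S) = inj₁ yx∈S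

  -- The index k of Reach S k x y is an upper bound on the number of steps.
  data Reach (S : List (V × V)) : ℕ → V → V → Set where
    here : ∀ {k x} → Reach S k x x
    step : ∀ {k x y z} → Joins S x y → Reach S k y z → Reach S (suc k) x z

  reach-≤ : ∀ {S k k′ x y} → k ≤ k′ → Reach S k x y → Reach S k′ x y
  reach-≤ _         here          = here
  reach-≤ (s≤s k≤k′) (step e r) = step e (reach-≤ k≤k′ r)

  reach-trans : ∀ {S j k x y z} → Reach S j x y → Reach S k y z → Reach S (j + k) x z
  reach-trans {j = j} here r = reach-≤ (m≤n+m _ j) r
  reach-trans (step e r) r′  = step e (reach-trans r r′)

  reach-sym : ∀ {S k x y} → Reach S k x y → Reach S k y x
  reach-sym here = here
  reach-sym {S} {suc k} {x} {y} (step e r) =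
    subst (λ j → Reach S j y x) (+-comm k 1) (reach-trans (reach-sym r) (step (joins-sym e) here))

  reach-⊆ : ∀ {S S′ k x y} → S ⊆ S′ → Reach S k x y → Reach S′ k x y
  reach-⊆ S⊆S′ here                  = here
  reach-⊆ S⊆S′ (step (inj₁ xy∈S) r) = step (inj₁ (S⊆S′ xy∈S)) (reach-⊆ S⊆S′ r)
  reach-⊆ S⊆S′ (step (inj₂ yx∈S) r) = step (inj₂ (S⊆S′ yx∈S)) (reach-⊆ S⊆S′ r)

reach-⌊log₂n⌋ : ∀ {n} {S : List (Fin n × Fin n)} i {x y} →
                8 ^ i ≤ n → Reach S (suc (i + i)) x y → Reach S ⌊log₂ n ⌋ x y
reach-⌊log₂n⌋ i {x} {y} 8^i≤n r with x Fin.≟ y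
... | yes refl = here
... | no  x≢y  = reach-≤ (suc[i+i]≤⌊log₂n⌋ i 8^i≤n (≢⇒2≤n x≢y)) r

module _ {n : ℕ} {G : TGraph n} where

  weaken : ∀ {lo lo′ u v} → lo ≤ lo′ → TWalk G lo′ u v → TWalk G lo u v
  weaken _     nil               = nil
  weaken lo≤lo′ (cons e lo′≤l p) = cons e (≤-trans lo≤lo′ lo′≤l) p

  len-weaken : ∀ {lo lo′ u v} (le : lo ≤ lo′) (p : TWalk G lo′ u v) → len (weaken le p) ≡ len p
  len-weaken _ nil          = refl
  len-weaken _ (cons _ _ _) = refl

  verts-weaken : ∀ {lo lo′ u v} (le : lo ≤ lo′) (p : TWalk G lo′ u v) → verts (weaken le p) ≡ verts p
  verts-weaken _ nil          = refl
  verts-weaken _ (cons _ _ _) = refl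

  ShorterPath : ∀ {lo u v} → TWalk G lo u v → Set
  ShorterPath {lo} {u} {v} p = Σ (TWalk G lo u v) (λ q → Unique (verts q) × len q ≤ len p)

  suffix : ∀ {lo w v u} (q : TWalk G lo w v) → Unique (verts q) → u ∈ verts q →
           Σ (TWalk G lo u v) (λ r → Unique (verts r) × len r ≤ len q)
  suffix nil          q! (here refl) = nil , q! , z≤n
  suffix (cons e le q) q! (here refl) = cons e le q , q! , ≤-refl
  suffix (cons e le q) (_ ∷ q!) (there u∈q) with suffix q q! u∈q
  ... | r , r! , r≤q = weaken le r , subst Unique (sym (verts-weaken le r)) r! ,
                       ≤-trans (≤-reflexive (len-weaken le r)) (m≤n⇒m≤1+n r≤q)

  shortcut : ∀ {lo u v} (p : TWalk G lo u v) → ShorterPath p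
  shortcut nil = nil , [] ∷ [] , z≤n
  shortcut {u = u} (cons e le p) with shortcut p
  ... | q , q! , q≤p with DecMembership._∈?_ Fin._≟_ u (verts q)
  ... | no  u∉q = cons e le q , ¬Any⇒All¬ _ u∉q ∷ q! , s≤s q≤p
  ... | yes u∈q with suffix q q! u∈q
  ...   | r , r! , r≤q = weaken le r , subst Unique (sym (verts-weaken le r)) r! ,
                         ≤-trans (≤-reflexive (len-weaken le r)) (m≤n⇒m≤1+n (≤-trans r≤q q≤p))

module Clustering {n : ℕ} {_~_ : Rel (Fin n) 0ℓ} (_~?_ : Decidable₂ _~_) (~-sym : Symmetric _~_) where

  open DecMembership (Fin._≟_ {n}) using (_∈?_)

  Edge : Set
  Edge = Fin n × Fin n

  attach : List (Fin n) → List (Fin n) → List Edge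
  attach B [] = []
  attach B (y ∷ ys) with any? (y ~?_) B
  ... | yes y~B = (y , proj₁ (find y~B)) ∷ attach B ys
  ... | no  _   = attach B ys

  length-attach : ∀ B ys → length (attach B ys) ≤ length ys
  length-attach B [] = z≤n
  length-attach B (y ∷ ys) with any? (y ~?_) B
  ... | yes _ = s≤s (length-attach B ys)
  ... | no  _ = m≤n⇒m≤1+n (length-attach B ys)

  attach-adjacent : ∀ B ys {x y} → (x , y) ∈ attach B ys → x ~ y × y ∈ B
  attach-adjacent B (z ∷ ys) e∈ with any? (z ~?_) B
  attach-adjacent B (z ∷ ys) (here refl) | yes z~B = let (_ , b∈B , z~b) = find z~B in z~b , b∈B
  attach-adjacent B (z ∷ ys) (there e∈) | yes _ = attach-adjacent B ys e∈
  attach-adjacent B (z ∷ ys) e∈         | no  _ = attach-adjacent B ys e∈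

  attach-complete : ∀ B ys {y} → y ∈ ys → Any (y ~_) B → ∃[ b ] (b ∈ B × (y , b) ∈ attach B ys)
  attach-complete B (z ∷ ys) y∈ y~B with any? (z ~?_) B
  attach-complete B (z ∷ ys) (here refl) _   | yes z~B = let (b , b∈B , _) = find z~B in b , b∈B , here refl
  attach-complete B (z ∷ ys) (here refl) y~B | no ¬z~B = ⊥-elim (¬z~B y~B)
  attach-complete B (z ∷ ys) (there y∈) y~B  | yes _ with attach-complete B ys y∈ y~B
  ... | b , b∈B , yb∈ = b , b∈B , there yb∈
  attach-complete B (z ∷ ys) (there y∈) y~B  | no  _ = attach-complete B ys y∈ y~B

  module Cluster {P : Pred (Fin n) 0ℓ} (P? : Decidable P) (c : Fin n) where

    OnBoundary : List (Fin n) → Fin n → Set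
    OnBoundary B y = P y × y ∉ B × Any (y ~_) B

    onBoundary? : ∀ B → Decidable (OnBoundary B)
    onBoundary? B y = P? y ×-dec ¬? (y ∈? B) ×-dec any? (y ~?_) B

    boundary : List (Fin n) → List (Fin n)
    boundary B = filter (onBoundary? B) (allFin n)

    boundary⁻ : ∀ {B y} → y ∈ boundary B → OnBoundary B y
    boundary⁻ {B} y∈∂ = proj₂ (∈-filter⁻ (onBoundary? B) {xs = allFin n} y∈∂)

    boundary⁺ : ∀ {B y} → OnBoundary B y → y ∈ boundary B
    boundary⁺ {B} {y} = ∈-filter⁺ (onBoundary? B) (∈-allFin y)

    record IsCluster (B : List (Fin n)) (i : ℕ) (E : List Edge) : Set where
      field
        unique   : Unique B
        alive    : ∀ {x} → x ∈ B → P x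
        centre   : c ∈ B
        radius   : ∀ {x} → x ∈ B → Reach E i x c
        adjacent : ∀ {x y} → (x , y) ∈ E → x ~ y
        sparse   : length E < length B
        large    : 8 ^ i ≤ length B

    module _ {B i E} (cl : IsCluster B i E) where
      open IsCluster cl

      boundary-reach : ∀ {y} → y ∈ boundary B → Reach (E ++ attach B (boundary B)) (suc i) y c
      boundary-reach y∈∂ with attach-complete B (boundary B) y∈∂ (proj₂ (proj₂ (boundary⁻ y∈∂)))
      ... | b , b∈B , yb∈ = step (inj₁ (∈-++⁺ʳ E yb∈)) (reach-⊆ ∈-++⁺ˡ (radius b∈B))

      attached-adjacent : ∀ {x y} → (x , y) ∈ E ++ attach B (boundary B) → x ~ y
      attached-adjacent xy∈ with ∈-++⁻ E xy∈
      ... | inj₁ xy∈E = adjacent xy∈E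
      ... | inj₂ xy∈A = proj₁ (attach-adjacent B (boundary B) xy∈A)

      expand : 7 * length B < length (boundary B) →
               IsCluster (B ++ boundary B) (suc i) (E ++ attach B (boundary B))
      expand growing = record
        { unique   = Unique.++⁺ unique (Unique.filter⁺ _ (Unique.allFin⁺ n))
                                (λ (v∈B , v∈∂) → proj₁ (proj₂ (boundary⁻ v∈∂)) v∈B)
        ; alive    = alive′
        ; centre   = ∈-++⁺ˡ centre
        ; radius   = radius′
        ; adjacent = attached-adjacent
        ; sparse   = sparse′
        ; large    = large′
        }
        where
        ∂ = boundary B
        alive′ : ∀ {x} → x ∈ B ++ ∂ → P x
        alive′ x∈ with ∈-++⁻ B x∈
        ... | inj₁ x∈B = alive x∈B
        ... | inj₂ x∈∂ = proj₁ (boundary⁻ x∈∂)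
        radius′ : ∀ {x} → x ∈ B ++ ∂ → Reach (E ++ attach B ∂) (suc i) x c
        radius′ x∈ with ∈-++⁻ B x∈
        ... | inj₁ x∈B = reach-≤ (n≤1+n i) (reach-⊆ ∈-++⁺ˡ (radius x∈B))
        ... | inj₂ x∈∂ = boundary-reach x∈∂
        sparse′ : length (E ++ attach B ∂) < length (B ++ ∂)
        sparse′ = begin-strict
          length (E ++ attach B ∂)          ≡⟨ length-++ E ⟩
          length E + length (attach B ∂)    <⟨ +-mono-<-≤ sparse (length-attach B ∂) ⟩
          length B + length ∂               ≡⟨ length-++ B ⟨
          length (B ++ ∂)                   ∎
          where open ≤-Reasoning
        large′ : 8 * 8 ^ i ≤ length (B ++ ∂)
        large′ = begin
          8 * 8 ^ i                ≤⟨ *-monoʳ-≤ 8 large ⟩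
          length B + 7 * length B  ≤⟨ +-monoʳ-≤ (length B) (<⇒≤ growing) ⟩
          length B + length ∂      ≡⟨ length-++ B ⟨
          length (B ++ ∂)          ∎
          where open ≤-Reasoning

    -- The fuel n is never exhausted, since every round adds a vertex.
    grow : ℕ → List (Fin n) → ℕ → List Edge → List (Fin n) × ℕ × List Edge
    grow fuel B i E with length (boundary B) ≤? 7 * length B
    ... | yes _ = B , i , E
    grow zero       B i E | no _ = B , i , E
    grow (suc fuel) B i E | no _ = grow fuel (B ++ boundary B) (suc i) (E ++ attach B (boundary B))

    Grown : List (Fin n) × ℕ × List Edge → Set
    Grown (B , i , E) = IsCluster B i E × length (boundary B) ≤ 7 * length B

    grow-grown : ∀ fuel {B i E} → IsCluster B i E → n < fuel + length B → Grown (grow fuel B i E)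
    grow-grown fuel {B} cl fuel-left with length (boundary B) ≤? 7 * length B
    ... | yes stopped = cl , stopped
    grow-grown zero cl fuel-left | no _ =
      ⊥-elim (<⇒≱ fuel-left (Unique⇒length≤n (IsCluster.unique cl)))
    grow-grown (suc fuel) {B} cl fuel-left | no ¬stopped =
      grow-grown fuel (expand cl growing) (begin-strict
        n                                        ≤⟨ ≤-pred fuel-left ⟩
        fuel + length B                          <⟨ +-monoʳ-< fuel (m<m+n (length B) (≤-<-trans z≤n growing)) ⟩
        fuel + (length B + length (boundary B))  ≡⟨ cong (fuel +_) (length-++ B) ⟨
        fuel + length (B ++ boundary B)          ∎)
      where
      open ≤-Reasoning
      growing = ≰⇒> ¬stopped

    cluster : List (Fin n) × ℕ × List Edge
    cluster = grow n [ c ] 0 []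

    members : List (Fin n)
    members = proj₁ cluster

    level : ℕ
    level = proj₁ (proj₂ cluster)

    edges : List Edge
    edges = proj₂ (proj₂ cluster) ++ attach members (boundary members)

    module _ (Pc : P c) where

      grown : Grown cluster
      grown = grow-grown n singleton (≤-reflexive (+-comm 1 n))
        where
        singleton : IsCluster [ c ] 0 []
        singleton = record
          { unique   = [] ∷ []
          ; alive    = λ { (here refl) → Pc }
          ; centre   = here refl
          ; radius   = λ { (here refl) → here }
          ; adjacent = λ ()
          ; sparse   = s≤s z≤n
          ; large    = s≤s z≤n
          }

      open IsCluster (proj₁ grown) public using (unique; alive; centre)

      edges-adjacent : ∀ {x y} → (x , y) ∈ edges → x ~ y
      edges-adjacent = attached-adjacent (proj₁ grown)

      length-edges : length edges ≤ 8 * length members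
      length-edges = begin
        length edges                           ≡⟨ length-++ tree ⟩
        length tree + length attached          ≤⟨ +-mono-≤ (<⇒≤ (IsCluster.sparse (proj₁ grown))) attached≤ ⟩
        length members + 7 * length members    ∎
        where
        open ≤-Reasoning
        tree = proj₂ (proj₂ cluster)
        attached = attach members (boundary members)
        attached≤ = ≤-trans (length-attach members (boundary members)) (proj₂ grown)

      8^level≤n : 8 ^ level ≤ n
      8^level≤n = ≤-trans (IsCluster.large (proj₁ grown)) (Unique⇒length≤n unique)

      members-reach : ∀ {x} → x ∈ members → Reach edges level x c
      members-reach x∈B = reach-⊆ ∈-++⁺ˡ (IsCluster.radius (proj₁ grown) x∈B)

      neighbour-reach : ∀ {y} → P y → Any (y ~_) members → Reach edges (suc level) y c
      neighbour-reach {y} Py y~B with y ∈? members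
      ... | yes y∈B = reach-≤ (n≤1+n level) (members-reach y∈B)
      ... | no  y∉B = boundary-reach (proj₁ grown) (boundary⁺ (Py , y∉B , y~B))

      member-stretch : ∀ {x y} → x ∈ members → P y → x ~ y → Reach edges ⌊log₂ n ⌋ x y
      member-stretch {x} {y} x∈B Py x~y = reach-⌊log₂n⌋ level 8^level≤n
        (subst (λ k → Reach edges k x y) (+-suc level level)
          (reach-trans (members-reach x∈B) (reach-sym (neighbour-reach Py (lose x∈B (~-sym x~y))))))

  module _ {P : Pred (Fin n) 0ℓ} (P? : Decidable P) (c : Fin n) where
    open Cluster P? c using (members)

    Uncovered : Pred (Fin n) 0ℓ
    Uncovered x = P x × x ∉ members

    uncovered? : Decidable Uncovered
    uncovered? x = P? x ×-dec ¬? (x ∈? members)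

  -- P holds the vertices not yet covered by a cluster.
  process : ∀ {P : Pred (Fin n) 0ℓ} → Decidable P → List (Fin n) → List Edge
  process P? [] = []
  process P? (c ∷ cs) with P? c
  ... | yes _ = Cluster.edges P? c ++ process (uncovered? P? c) cs
  ... | no  _ = process P? cs

  process-adjacent : ∀ {P : Pred (Fin n) 0ℓ} (P? : Decidable P) cs {x y} → (x , y) ∈ process P? cs → x ~ y
  process-adjacent P? (c ∷ cs) xy∈ with P? c
  ... | no  _  = process-adjacent P? cs xy∈
  ... | yes Pc with ∈-++⁻ (Cluster.edges P? c) xy∈
  ...   | inj₁ xy∈E = Cluster.edges-adjacent P? c Pc xy∈E
  ...   | inj₂ xy∈S = process-adjacent (uncovered? P? c) cs xy∈S

  length-process : ∀ {P : Pred (Fin n) 0ℓ} (P? : Decidable P) cs →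
                   length (process P? cs) ≤ 8 * length (filter P? (allFin n))
  length-process P? [] = z≤n
  length-process P? (c ∷ cs) with P? c
  ... | no  _  = length-process P? cs
  ... | yes Pc = begin
    length (edges ++ process P′? cs)                  ≡⟨ length-++ edges ⟩
    length edges + length (process P′? cs)            ≤⟨ +-mono-≤ (length-edges Pc) (length-process P′? cs) ⟩
    8 * length members + 8 * length (filter P′? all)  ≡⟨ *-distribˡ-+ 8 (length members) _ ⟨
    8 * (length members + length (filter P′? all))    ≡⟨ cong (8 *_) (length-++ members) ⟨
    8 * length (members ++ filter P′? all)            ≤⟨ *-monoʳ-≤ 8 (Unique-⊆⇒length≤ disjoint-union ⊆P) ⟩
    8 * length (filter P? all)                        ∎
    where
    open ≤-Reasoning
    open Cluster P? c using (edges; members; length-edges; unique; alive)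
    all = allFin n
    P′? = uncovered? P? c
    disjoint-union : Unique (members ++ filter P′? all)
    disjoint-union = Unique.++⁺ (unique Pc) (Unique.filter⁺ P′? (Unique.allFin⁺ n))
                       (λ (x∈B , x∈P′) → proj₂ (proj₂ (∈-filter⁻ P′? {xs = all} x∈P′)) x∈B)
    ⊆P : members ++ filter P′? all ⊆ filter P? all
    ⊆P {x} x∈ with ∈-++⁻ members x∈
    ... | inj₁ x∈B  = ∈-filter⁺ P? (∈-allFin x) (alive Pc x∈B)
    ... | inj₂ x∈P′ = ∈-filter⁺ P? (∈-allFin x) (proj₁ (proj₂ (∈-filter⁻ P′? {xs = all} x∈P′)))

  process-stretch : ∀ {P : Pred (Fin n) 0ℓ} (P? : Decidable P) cs → (∀ {x} → P x → x ∈ cs) →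
                    ∀ {x y} → P x → P y → x ~ y → Reach (process P? cs) ⌊log₂ n ⌋ x y
  process-stretch P? [] covered Px _ _ with () ← covered Px
  process-stretch P? (c ∷ cs) covered {x} {y} Px Py x~y with P? c
  ... | no ¬Pc = process-stretch P? cs (covered-by-tail covered ¬Pc) Px Py x~y
  ... | yes Pc with x ∈? members | y ∈? members
    where open Cluster P? c using (members)
  ... | yes x∈B | _       = reach-⊆ ∈-++⁺ˡ (Cluster.member-stretch P? c Pc x∈B Py x~y)
  ... | no _    | yes y∈B = reach-⊆ ∈-++⁺ˡ (reach-sym (Cluster.member-stretch P? c Pc y∈B Px (~-sym x~y)))
  ... | no x∉B  | no y∉B  =
    reach-⊆ (∈-++⁺ʳ _) (process-stretch (uncovered? P? c) cs covered′ (Px , x∉B) (Py , y∉B) x~y)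
    where
    covered′ = covered-by-tail {Q = Uncovered P? c} (covered ∘ proj₁)
                               (λ (_ , c∉B) → c∉B (Cluster.centre P? c Pc))

  spanner : List Edge
  spanner = process U? (allFin n)

  spanner-adjacent : ∀ {x y} → (x , y) ∈ spanner → x ~ y
  spanner-adjacent = process-adjacent U? (allFin n)

  length-spanner : length spanner ≤ 8 * n
  length-spanner = ≤-trans (length-process U? (allFin n))
    (*-monoʳ-≤ 8 (≤-trans (length-filter U? (allFin n)) (≤-reflexive (length-tabulate {n = n} (λ i → i)))))

  spanner-stretch : ∀ {x y} → x ~ y → Reach spanner ⌊log₂ n ⌋ x y
  spanner-stretch = process-stretch U? (allFin n) (λ {x} _ → ∈-allFin x) _ _

module TemporalSpanner {n : ℕ} (G : TGraph n) where

  open DecMembership (Product.≡-dec (Fin._≟_ {n}) (Fin._≟_ {n})) using (_∈?_)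

  Labelled : ℕ → Rel (Fin n) 0ℓ
  Labelled l x y = lab G x y ≡ just l

  labelled? : ∀ l → Decidable₂ (Labelled l)
  labelled? l x y = Maybe.≡-dec _≟_ (lab G x y) (just l)

  labelled-sym : ∀ l → Symmetric (Labelled l)
  labelled-sym l {x} {y} xy≡l = trans (lab-sym G y x) xy≡l

  module Static (l : ℕ) = Clustering (labelled? l) (labelled-sym l)

  S : ℕ → List (Fin n × Fin n)
  S l = Static.spanner l

  joins? : ∀ E x y → Dec (Joins E x y)
  joins? E x y = (x , y) ∈? E ⊎-dec (y , x) ∈? E

  joins-labelled : ∀ {l x y} → Joins (S l) x y → Labelled l x y
  joins-labelled {l} (inj₁ xy∈S) = Static.spanner-adjacent l xy∈S
  joins-labelled {l} (inj₂ yx∈S) = labelled-sym l (Static.spanner-adjacent l yx∈S)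

  restrict : Maybe ℕ → Fin n → Fin n → Maybe ℕ
  restrict nothing  _ _ = nothing
  restrict (just l) x y with joins? (S l) x y
  ... | yes _ = just l
  ... | no  _ = nothing

  restrict-sym : ∀ m x y → restrict m x y ≡ restrict m y x
  restrict-sym nothing  _ _ = refl
  restrict-sym (just l) x y with joins? (S l) x y | joins? (S l) y x
  ... | yes _  | yes _  = refl
  ... | no  _  | no  _  = refl
  ... | yes j  | no ¬j′ = ⊥-elim (¬j′ (joins-sym j))
  ... | no ¬j  | yes j′ = ⊥-elim (¬j (joins-sym j′))

  restrict⁻ : ∀ m x y {l} → restrict m x y ≡ just l → m ≡ just l × Joins (S l) x y
  restrict⁻ (just l) x y e with joins? (S l) x y
  restrict⁻ (just l) x y refl | yes j = refl , j

  H : TGraph n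
  H = record
    { lab     = λ u v → restrict (lab G u v) u v
    ; lab-sym = λ u v → trans (cong (λ m → restrict m u v) (lab-sym G u v)) (restrict-sym (lab G v u) u v)
    ; lab-irr = λ u → cong (λ m → restrict m u u) (lab-irr G u)
    ; lab-pos = λ u v l e → lab-pos G u v l (proj₁ (restrict⁻ (lab G u v) u v e))
    }

  lab-H⁻ : ∀ {x y l} → lab H x y ≡ just l → Labelled l x y × Joins (S l) x y
  lab-H⁻ {x} {y} = restrict⁻ (lab G x y) x y

  lab-H⁺ : ∀ {x y l} → Joins (S l) x y → lab H x y ≡ just l
  lab-H⁺ {x} {y} {l} j rewrite joins-labelled j with joins? (S l) x y
  ... | yes _ = refl
  ... | no ¬j = ⊥-elim (¬j j)

  H⊑G : H ⊑ G
  H⊑G u v l e = proj₁ (lab-H⁻ e)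

  -- A route in a static spanner uses a single label, so it is a temporal walk of H.
  reach⇒walk : ∀ {l k x y} → Reach (S l) k x y → ∀ {lo v} → lo ≤ l → (q : TWalk H l y v) →
               Σ (TWalk H lo x v) (λ w → len w ≤ k + len q)
  reach⇒walk {k = k} here lo≤l q = weaken lo≤l q , ≤-trans (≤-reflexive (len-weaken lo≤l q)) (m≤n+m _ k)
  reach⇒walk (step j r) lo≤l q with reach⇒walk r ≤-refl q
  ... | w , w≤ = cons (lab-H⁺ j) lo≤l w , s≤s w≤

  translate : ∀ {lo u v} (p : TWalk G lo u v) → Σ (TWalk H lo u v) (λ w → len w ≤ ⌊log₂ n ⌋ * len p)
  translate nil = nil , z≤n
  translate (cons {l = l} e lo≤l p) with translate p
  ... | w , w≤ with reach⇒walk (Static.spanner-stretch l e) lo≤l w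
  ... | w′ , w′≤ = w′ , (begin
    len w′                          ≤⟨ w′≤ ⟩
    ⌊log₂ n ⌋ + len w               ≤⟨ +-monoʳ-≤ ⌊log₂ n ⌋ w≤ ⟩
    ⌊log₂ n ⌋ + ⌊log₂ n ⌋ * len p   ≡⟨ *-suc ⌊log₂ n ⌋ (len p) ⟨
    ⌊log₂ n ⌋ * suc (len p)         ∎)
    where open ≤-Reasoning

  H-spanner : IsSpanner ⌊log₂ n ⌋ G H
  H-spanner = H⊑G , λ u v P →
    let w , w≤ = translate (proj₁ P)
        q , q! , q≤w = shortcut w
    in (q , q!) , ≤-trans q≤w w≤

  labels : List ℕ
  labels = deduplicate _≟_ (mapMaybe (λ p → lab G (proj₁ p) (proj₂ p)) (pairs n))

  -- S l may list an edge of H in either orientation, while size counts it once as (u , v) with u < v.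
  bothWays : List (Fin n × Fin n) → List (Fin n × Fin n)
  bothWays E = E ++ map swap E

  length-bothWays-S : ∀ l → length (bothWays (S l)) ≤ 16 * n
  length-bothWays-S l = begin
    length (S l ++ map swap (S l))          ≡⟨ length-++ (S l) ⟩
    length (S l) + length (map swap (S l))  ≡⟨ cong (length (S l) +_) (length-map swap (S l)) ⟩
    length (S l) + length (S l)             ≤⟨ +-mono-≤ (Static.length-spanner l) (Static.length-spanner l) ⟩
    8 * n + 8 * n                           ≡⟨ *-distribʳ-+ n 8 8 ⟨
    16 * n                                  ∎
    where open ≤-Reasoning

  H-edges : List (Fin n × Fin n)
  H-edges = filter (λ p → T? (is-just (lab H (proj₁ p) (proj₂ p)))) (pairs n)

  H-edges⊆ : H-edges ⊆ concatMap (bothWays ∘ S) labels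
  H-edges⊆ {u , v} uv∈ with ∈-filter⁻ (λ p → T? (is-just (lab H (proj₁ p) (proj₂ p)))) {xs = pairs n} uv∈
  ... | uv∈pairs , kept with lab H u v in e
  ... | nothing = ⊥-elim kept
  ... | just l with lab-H⁻ {u} {v} e
  ...   | uv≡l , j = ∈-concatMap⁺ (bothWays ∘ S) (Any.map (λ { refl → joins⇒∈ j }) l∈labels)
    where
    l∈labels : l ∈ labels
    l∈labels = ∈-deduplicate⁺ _≟_ (∈-mapMaybe⁺ (λ p → lab G (proj₁ p) (proj₂ p)) uv∈pairs uv≡l)
    joins⇒∈ : Joins (S l) u v → (u , v) ∈ bothWays (S l)
    joins⇒∈ (inj₁ uv∈S) = ∈-++⁺ˡ uv∈S
    joins⇒∈ (inj₂ vu∈S) = ∈-++⁺ʳ (S l) (∈-map⁺ swap vu∈S)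

  size-H : size H ≤ 16 * (lifetime G * n)
  size-H = begin
    size H                                   ≤⟨ Unique-⊆⇒length≤ H-edges! H-edges⊆ ⟩
    length (concatMap (bothWays ∘ S) labels) ≤⟨ length-concatMap-≤ (bothWays ∘ S) length-bothWays-S labels ⟩
    length labels * (16 * n)                 ≡⟨ *-assoc (length labels) 16 n ⟨
    length labels * 16 * n                   ≡⟨ cong (_* n) (*-comm (length labels) 16) ⟩
    16 * length labels * n                   ≡⟨ *-assoc 16 (length labels) n ⟩
    16 * (length labels * n)                 ∎
    where
    open ≤-Reasoning
    H-edges! : Unique H-edges
    H-edges! = Unique.filter⁺ _ (Unique.filter⁺ _
                 (Unique.cartesianProduct⁺ (Unique.allFin⁺ n) (Unique.allFin⁺ n)))

mainTheorem10 : ∃[ C ] ((n : ℕ) (G : TGraph n) →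
                  ∃[ H ] (IsSpanner ⌊log₂ n ⌋ G H × size H ≤ C * (lifetime G * n)))
mainTheorem10 = 16 , λ n G → let open TemporalSpanner G in H , H-spanner , size-H
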